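{- Let $E$ be a finite set of edges, $p\in[0,1]$, and let $P_1,\dots,P_r$ be a fixed sequence of partitions of $E$ into groups, where each group of each partition is (deterministically) designated either "small" or not. Consider the following random procedure: independently for each small group $B$ of each partition, draw $X_B\sim \mathrm{Bin}(|B|,p)$ and then choose a uniformly random subset $S_B\subseteq B$ of size $X_B$ (without replacement). For each edge $e$ let $f(e)$ be the smallest $i$ such that $e$ lies in a small group of $P_i$, and put $e$ in the output set $S$ iff $e\in S_B$ for the small group $B$ of $P_{f(e)}$ containing $e$. Assume that for every edge $e\in E$ there exists a partition $P_i$ in which $e$ lies in a small group. Then the distribution of $S$ is the same as that of the set obtained by including each edge of $E$ independently with probability $p$.
   Context: $\mathrm{Bin}(g,p)$ denotes the binomial distribution with $g$ trials and success probability $p$.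
   Formalization: The parameter $p$ ranges only over the rationals in $[0,1]$. -}

module Defs where

open import Data.Bool using (Bool; true; false; _∧_; if_then_else_)
open import Data.Nat using (ℕ; zero; suc)
open import Data.Nat.Combinatorics using (_C_)
open import Data.Fin using (Fin)
open import Data.List using (List; []; _∷_; map; concatMap; foldr)
open import Data.Maybe using (Maybe; just; nothing)
open import Data.Vec using (Vec; []; _∷_; tabulate)
open import Data.Vec.Functional using (Vector)
import Data.Integer as ℤ
open import Data.Rational using (ℚ; 0ℚ; 1ℚ; _+_; _*_; _-_; _/_)

-- Edge set E = Fin n.  A subset of E is a characteristic function Fin n → Bool.
SubsetE : ℕ → Set
SubsetE n = Fin n → Bool

-- A sequence P_1..P_r of partitions of E, each group tagged small or not.
-- Partition i has groups labelled by Fin (m i); grp i e is the group of e in P_i.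
record Partitions (n r : ℕ) : Set where
  field
    m     : Fin r → ℕ
    grp   : (i : Fin r) → Fin n → Fin (m i)
    small : (i : Fin r) → Fin (m i) → Bool
open Partitions public

Σℚ : List ℚ → ℚ
Σℚ = foldr _+_ 0ℚ

Πℚ : List ℚ → ℚ
Πℚ = foldr _*_ 1ℚ

allFins : (k : ℕ) → List (Fin k)
allFins k = Data.Vec.toList (tabulate (λ i → i))
  where import Data.Vec

ΣF : (k : ℕ) → (Fin k → ℚ) → ℚ
ΣF k f = Σℚ (map f (allFins k))

ΠF : (k : ℕ) → (Fin k → ℚ) → ℚ
ΠF k f = Πℚ (map f (allFins k))

countF : (k : ℕ) → (Fin k → Bool) → ℕ
countF zero    f = 0
countF (suc k) f = (if f Fin.zero then 1 else 0) Data.Nat.+ countF k (λ i → f (Fin.suc i))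
  where import Data.Fin as Fin

allFuns : {A : Set} → List A → (k : ℕ) → List (Fin k → A)
allFuns xs zero    = (λ ()) ∷ []
allFuns xs (suc k) = concatMap (λ a → map (λ g → cons a g) (allFuns xs k)) xs
  where
  cons : {A : Set} → A → (Fin k → A) → Fin (suc k) → A
  cons a g Fin.zero    = a
  cons a g (Fin.suc i) = g i
    where import Data.Fin as Fin

allSubsetsE : (n : ℕ) → List (SubsetE n)
allSubsetsE n = allFuns (true ∷ false ∷ []) n

_^ℚ_ : ℚ → ℕ → ℚ
q ^ℚ zero  = 1ℚ
q ^ℚ suc k = q * (q ^ℚ k)

fromℕ : ℕ → ℚ
fromℕ k = ℤ.+ k / 1

-- 1/k for k ≥ 1 (value at 0 irrelevant: only used with k = C(g,j) ≥ 1)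
inv : ℕ → ℚ
inv zero    = 0ℚ
inv (suc k) = ℤ.+ 1 / suc k

binPmf : ℚ → ℕ → ℕ → ℚ
binPmf p g k = fromℕ (g C k) * (p ^ℚ k) * ((1ℚ - p) ^ℚ (g Data.Nat.∸ k))

_==_ : ℕ → ℕ → Bool
zero  == zero  = true
suc a == suc b = a == b
_     == _     = false

-- Probability that, for a group of size g, the procedure
-- "draw X ~ Bin(g,p), then a uniform X-subset" yields a given subset of size a:
--   Σ_{k=0}^{g} P(X = k) · [a = k] / C(g,k)
groupSubsetProb : ℚ → ℕ → ℕ → ℚ
groupSubsetProb p g a =
  ΣF (suc g) (λ k → binPmf p g (Data.Fin.toℕ k) *
                    (if a == Data.Fin.toℕ k then inv (g C Data.Fin.toℕ k) else 0ℚ))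

_==F_ : {k : ℕ} → Fin k → Fin k → Bool
a ==F b = Data.Fin.toℕ a == Data.Fin.toℕ b

-- An outcome ω assigns to each partition i a subset A_i ⊆ E; for a group B of
-- P_i the chosen set is S_B = A_i ∩ B.  Its probability is the product over all
-- groups of P_i, i ∈ [r]: for small B, the probability that S_B = A_i ∩ B;
-- for non-small B, the indicator that A_i ∩ B = ∅ (nothing is drawn there).
Outcome : ℕ → ℕ → Set
Outcome n r = Fin r → SubsetE n

outcomeProb : {n r : ℕ} → ℚ → Partitions n r → Outcome n r → ℚ
outcomeProb {n} {r} p P ω =
  ΠF r (λ i → ΠF (m P i) (λ b →
    let inB  = λ (e : Fin n) → grp P i e ==F b
        size = countF n inB
        cnt  = countF n (λ e → inB e ∧ ω i e)
    in if small P i b then groupSubsetProb p size cnt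
       else (if cnt == 0 then 1ℚ else 0ℚ)))

firstSmall : {n r : ℕ} → Partitions n r → Fin n → Maybe (Fin r)
firstSmall {n} {r} P e = go (allFins r)
  where
  go : List (Fin r) → Maybe (Fin r)
  go []       = nothing
  go (i ∷ is) = if small P i (grp P i e) then just i else go is

output : {n r : ℕ} → Partitions n r → Outcome n r → SubsetE n
output P ω e with firstSmall P e
... | just i  = ω i e
... | nothing = false

_==S_ : {n : ℕ} → SubsetE n → SubsetE n → Bool
_==S_ {n} S T = countF n (λ e → xnor (S e) (T e)) == n
  where
  xnor : Bool → Bool → Bool
  xnor true  b = b
  xnor false true  = false
  xnor false false = true

probOutput : {n r : ℕ} → ℚ → Partitions n r → SubsetE n → ℚ
probOutput {n} {r} p P T =
  Σℚ (map (λ ω → if output P ω ==S T then outcomeProb p P ω else 0ℚ)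
          (allFuns (allSubsetsE n) r))

probIndep : {n : ℕ} → ℚ → SubsetE n → ℚ
probIndep {n} p T = (p ^ℚ k) * ((1ℚ - p) ^ℚ (n Data.Nat.∸ k))
  where k = countF n T

{-# OPTIONS --safe #-}
-- Drawing X ~ Bin(g, p) and then a uniform X-subset of a g-element group gives every fixed
-- subset of size a the probability C(g,a) p^a (1-p)^(g-a) / C(g,a) = p^a (1-p)^(g-a), exactly as
-- if each edge of the group were kept independently with probability p; a non-small group draws
-- nothing, which is independent inclusion with probability 0.  So an outcome ω = (A_i)_i has
-- probability ∏_{i,e} of Bernoulli weights of A_i(e).  The event S = T constrains, for each edge e,
-- only the coordinate A_{f(e)}(e), whose weight is Bernoulli(p) since e's group in P_{f(e)} is
-- small.  Hence the sum over ω factorises over the pairs (i, e): an unconstrained pair contributes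
-- total mass 1 and the pair (f(e), e) contributes p or 1 - p according as e ∈ T.
module Submission where

open import Defs
open import Data.Nat using (ℕ)
open import Data.Fin using (Fin)
open import Data.Bool using (true)
open import Data.Product using (∃)
open import Data.Rational using (ℚ; 0ℚ; 1ℚ; _≤_)
open import Relation.Binary.PropositionalEquality using (_≡_)

open import Algebra.Bundles using (CommutativeMonoid)
open import Data.Bool using (Bool; false; if_then_else_; _∧_)
import Data.Integer as ℤ
open import Data.Fin using (zero; suc; toℕ; fromℕ<; punchIn)
open import Data.Fin.Properties using (toℕ-injective; toℕ-fromℕ<; punchInᵢ≢i)
open import Data.List using (List; []; _∷_; map; foldr; concatMap; _++_; tabulate; allFin; findᵇ)
open import Data.List.Properties using (map-++; map-∘; map-cong; map-tabulate)
open import Data.List.Membership.Propositional using (_∈_)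
open import Data.List.Membership.Propositional.Properties using (∈-allFin)
open import Data.List.Relation.Unary.Any using (here; there)
open import Data.Maybe using (Maybe; just; nothing)
import Data.Nat as ℕ
open import Data.Nat using (zero; suc; _∸_; z≤n; s≤s)
import Data.Nat.Properties as ℕ
import Data.Nat.Coprimality as Coprime
open import Data.Nat.Combinatorics using (_C_; nCk+nC[k+1]≡[n+1]C[k+1])
open import Data.Product using (_,_; _×_; proj₁; proj₂)
open import Data.Rational using (mkℚ; _+_; _*_; _-_; 1/_)
open import Data.Rational.Properties
  using (↥p/↧p≡p; *-inverseʳ; +-identityˡ; +-identityʳ; *-identityˡ; *-identityʳ; *-zeroˡ; *-zeroʳ;
         *-assoc; +-assoc; *-distribˡ-+; *-distribʳ-+; +-0-commutativeMonoid; *-1-commutativeMonoid)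
open import Data.Rational.Solver using (module +-*-Solver)
open +-*-Solver using (solve; con; _:+_; _:*_; _:-_; _:=_)
import Data.Vec as Vec
import Data.Vec.Functional as Vector
open import Data.Vec.Functional using (Vector; removeAt; replicate)
open import Function using (_∘_)
open import Relation.Binary.PropositionalEquality
  using (refl; sym; trans; cong; cong₂; subst; _≢_; module ≡-Reasoning)
open import Relation.Nullary using (contradiction)
open import Algebra.Properties.CommutativeSemigroup
  (CommutativeMonoid.commutativeSemigroup *-1-commutativeMonoid)
  using (x∙yz≈y∙xz; xy∙z≈xz∙y)

module _ {a ℓ} (M : CommutativeMonoid a ℓ) where
  open CommutativeMonoid M
  open import Algebra.Properties.CommutativeMonoid.Sum M
  open import Relation.Binary.Reasoning.Setoid setoid

  sum-concentrated : ∀ {n} (f : Vector Carrier n) c → (∀ i → i ≢ c → f i ≈ ε) → sum f ≈ f c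
  sum-concentrated {suc n} f c vanish = begin
    sum f                     ≈⟨ sum-remove {i = c} f ⟩
    f c ∙ sum (removeAt f c)  ≈⟨ ∙-congˡ (sum-cong-≋ λ j → vanish (punchIn c j) (punchInᵢ≢i c j)) ⟩
    f c ∙ sum (replicate n ε) ≈⟨ ∙-congˡ (sum-replicate-zero n) ⟩
    f c ∙ ε                   ≈⟨ identityʳ (f c) ⟩
    f c                       ∎

open import Algebra.Properties.CommutativeMonoid.Sum +-0-commutativeMonoid
  using () renaming (sum to ∑)
open import Algebra.Properties.CommutativeMonoid.Sum *-1-commutativeMonoid
  using () renaming (sum to ∏; sum-cong-≗ to ∏-cong; ∑-comm to ∏-comm; ∑-distrib-+ to ∏-distrib-*)

∑-concentrated : ∀ {n} (f : Fin n → ℚ) c → (∀ i → i ≢ c → f i ≡ 0ℚ) → ∑ f ≡ f c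
∑-concentrated = sum-concentrated +-0-commutativeMonoid

∏-concentrated : ∀ {n} (f : Fin n → ℚ) c → (∀ i → i ≢ c → f i ≡ 1ℚ) → ∏ f ≡ f c
∏-concentrated = sum-concentrated *-1-commutativeMonoid

toList-tabulate : ∀ {A : Set} {k} (f : Fin k → A) → Vec.toList (Vec.tabulate f) ≡ tabulate f
toList-tabulate {k = zero}  f = refl
toList-tabulate {k = suc k} f = cong (f zero ∷_) (toList-tabulate (f ∘ suc))

allFins≡allFin : ∀ k → allFins k ≡ allFin k
allFins≡allFin k = toList-tabulate (λ i → i)

foldr-tabulate : ∀ {A B : Set} (_∙_ : A → B → B) e {k} (f : Fin k → A) →
                 foldr _∙_ e (tabulate f) ≡ Vector.foldr _∙_ e f
foldr-tabulate _∙_ e {zero}  f = refl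
foldr-tabulate _∙_ e {suc k} f = cong (f zero ∙_) (foldr-tabulate _∙_ e (f ∘ suc))

foldr-map-allFins : ∀ {A B : Set} (_∙_ : A → B → B) e {k} (f : Fin k → A) →
                    foldr _∙_ e (map f (allFins k)) ≡ Vector.foldr _∙_ e f
foldr-map-allFins _∙_ e {k} f = begin
  foldr _∙_ e (map f (allFins k))  ≡⟨ cong (foldr _∙_ e ∘ map f) (allFins≡allFin k) ⟩
  foldr _∙_ e (map f (allFin k))   ≡⟨ cong (foldr _∙_ e) (map-tabulate (λ i → i) f) ⟩
  foldr _∙_ e (tabulate f)         ≡⟨ foldr-tabulate _∙_ e f ⟩
  Vector.foldr _∙_ e f             ∎
  where open ≡-Reasoning

ΣF≡∑ : ∀ k (f : Fin k → ℚ) → ΣF k f ≡ ∑ f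
ΣF≡∑ k = foldr-map-allFins _+_ 0ℚ

ΠF≡∏ : ∀ k (f : Fin k → ℚ) → ΠF k f ≡ ∏ f
ΠF≡∏ k = foldr-map-allFins _*_ 1ℚ

==-refl : ∀ m → (m == m) ≡ true
==-refl zero    = refl
==-refl (suc m) = ==-refl m

==⇒≡ : ∀ m n → (m == n) ≡ true → m ≡ n
==⇒≡ zero    zero    _  = refl
==⇒≡ (suc m) (suc n) eq = cong suc (==⇒≡ m n eq)

==F-refl : ∀ {k} (c : Fin k) → (c ==F c) ≡ true
==F-refl c = ==-refl (toℕ c)

==F⇒≡ : ∀ {k} (c d : Fin k) → (c ==F d) ≡ true → c ≡ d
==F⇒≡ c d eq = toℕ-injective (==⇒≡ (toℕ c) (toℕ d) eq)

∏-if-==F : ∀ {k} (c : Fin k) (f : Fin k → ℚ) → ∏ (λ i → if c ==F i then f i else 1ℚ) ≡ f c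
∏-if-==F c f = trans (∏-concentrated _ c off) (cong (λ b → if b then f c else 1ℚ) (==F-refl c))
  where
  off : ∀ i → i ≢ c → (if c ==F i then f i else 1ℚ) ≡ 1ℚ
  off i i≢c with c ==F i in eq
  ... | true  = contradiction (sym (==F⇒≡ c i eq)) i≢c
  ... | false = refl

countF-true : ∀ n → countF n (λ _ → true) ≡ n
countF-true zero    = refl
countF-true (suc n) = cong suc (countF-true n)

countF-≤ : ∀ n (A : SubsetE n) → countF n A ℕ.≤ n
countF-≤ zero    A = z≤n
countF-≤ (suc n) A with A zero
... | true  = s≤s (countF-≤ n (A ∘ suc))
... | false = ℕ.m≤n⇒m≤1+n (countF-≤ n (A ∘ suc))

countF-∧-≤ : ∀ n (B A : SubsetE n) → countF n (λ e → B e ∧ A e) ℕ.≤ countF n B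
countF-∧-≤ zero    B A = z≤n
countF-∧-≤ (suc n) B A with B zero | A zero
... | true  | true  = s≤s (countF-∧-≤ n (B ∘ suc) (A ∘ suc))
... | true  | false = ℕ.m≤n⇒m≤1+n (countF-∧-≤ n (B ∘ suc) (A ∘ suc))
... | false | _     = countF-∧-≤ n (B ∘ suc) (A ∘ suc)

bernoulli : ℚ → Bool → ℚ
bernoulli q true  = q
bernoulli q false = 1ℚ - q

indepSubsetProb : ℚ → ℕ → ℕ → ℚ
indepSubsetProb q g a = (q ^ℚ a) * ((1ℚ - q) ^ℚ (g ∸ a))

indicator : Bool → ℚ
indicator b = if b then 1ℚ else 0ℚ

∏-bernoulli : ∀ q n (B A : SubsetE n) →
  ∏ (λ e → if B e then bernoulli q (A e) else 1ℚ)
  ≡ indepSubsetProb q (countF n B) (countF n (λ e → B e ∧ A e))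
∏-bernoulli q zero    B A = sym (*-identityʳ 1ℚ)
∏-bernoulli q (suc n) B A with B zero | A zero
... | true  | true  = trans (cong (q *_) (∏-bernoulli q n (B ∘ suc) (A ∘ suc))) (sym (*-assoc q _ _))
... | false | _     = trans (*-identityˡ _) (∏-bernoulli q n (B ∘ suc) (A ∘ suc))
... | true  | false = begin
  (1ℚ - q) * ∏ (λ e → if B (suc e) then bernoulli q (A (suc e)) else 1ℚ)
    ≡⟨ cong ((1ℚ - q) *_) (∏-bernoulli q n (B ∘ suc) (A ∘ suc)) ⟩
  (1ℚ - q) * ((q ^ℚ a) * ((1ℚ - q) ^ℚ (g ∸ a)))
    ≡⟨ x∙yz≈y∙xz (1ℚ - q) (q ^ℚ a) _ ⟩
  (q ^ℚ a) * ((1ℚ - q) ^ℚ suc (g ∸ a))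
    ≡⟨ cong (λ k → (q ^ℚ a) * ((1ℚ - q) ^ℚ k)) (ℕ.+-∸-assoc 1 (countF-∧-≤ n (B ∘ suc) (A ∘ suc))) ⟨
  indepSubsetProb q (suc g) a ∎
  where
  open ≡-Reasoning
  g = countF n (B ∘ suc)
  a = countF n (λ e → B (suc e) ∧ A (suc e))

1^ℚ : ∀ k → 1ℚ ^ℚ k ≡ 1ℚ
1^ℚ zero    = refl
1^ℚ (suc k) = trans (*-identityˡ _) (1^ℚ k)

indepSubsetProb-0 : ∀ g a → indepSubsetProb 0ℚ g a ≡ indicator (a == 0)
indepSubsetProb-0 g zero    = trans (*-identityˡ _) (1^ℚ g)
indepSubsetProb-0 g (suc a) = trans (cong (_* w) (*-zeroˡ (0ℚ ^ℚ a))) (*-zeroˡ w)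
  where w = (1ℚ - 0ℚ) ^ℚ (g ∸ suc a)

k≤n⇒nCk>0 : ∀ {n k} → k ℕ.≤ n → 0 ℕ.< n C k
k≤n⇒nCk>0 {n}     {zero}  _         = s≤s z≤n
k≤n⇒nCk>0 {suc n} {suc k} (s≤s k≤n) =
  subst (0 ℕ.<_) (nCk+nC[k+1]≡[n+1]C[k+1] n k) (ℕ.<-≤-trans (k≤n⇒nCk>0 k≤n) (ℕ.m≤m+n _ _))

fromℕ*inv : ∀ {c} → 0 ℕ.< c → fromℕ c * inv c ≡ 1ℚ
fromℕ*inv {suc c} _ = begin
  fromℕ (suc c) * inv (suc c) ≡⟨ cong₂ _*_ (↥p/↧p≡p q) (↥p/↧p≡p (1/ q)) ⟩
  q * 1/ q                    ≡⟨ *-inverseʳ q ⟩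
  1ℚ                          ∎
  where
  open ≡-Reasoning
  q = mkℚ (ℤ.+ suc c) 0 (Coprime.sym (Coprime.1-coprimeTo (suc c)))

groupSubsetProb≡indepSubsetProb : ∀ p {g a} → a ℕ.≤ g → groupSubsetProb p g a ≡ indepSubsetProb p g a
groupSubsetProb≡indepSubsetProb p {g} {a} a≤g = begin
  groupSubsetProb p g a
    ≡⟨ ΣF≡∑ (suc g) term ⟩
  ∑ term
    ≡⟨ ∑-concentrated term c off ⟩
  term c
    ≡⟨ cong term′ (toℕ-fromℕ< (s≤s a≤g)) ⟩
  term′ a
    ≡⟨ cong (λ b → binPmf p g a * (if b then inv (g C a) else 0ℚ)) (==-refl a) ⟩
  ((fromℕ (g C a) * x) * y) * inv (g C a)
    ≡⟨ cong (_* inv (g C a)) (*-assoc (fromℕ (g C a)) x y) ⟩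
  (fromℕ (g C a) * (x * y)) * inv (g C a)
    ≡⟨ xy∙z≈xz∙y (fromℕ (g C a)) (x * y) (inv (g C a)) ⟩
  (fromℕ (g C a) * inv (g C a)) * (x * y)
    ≡⟨ cong (_* (x * y)) (fromℕ*inv (k≤n⇒nCk>0 a≤g)) ⟩
  1ℚ * (x * y)
    ≡⟨ *-identityˡ (x * y) ⟩
  indepSubsetProb p g a ∎
  where
  open ≡-Reasoning
  x = p ^ℚ a
  y = (1ℚ - p) ^ℚ (g ∸ a)
  term′ : ℕ → ℚ
  term′ k = binPmf p g k * (if a == k then inv (g C k) else 0ℚ)
  term : Fin (suc g) → ℚ
  term k = term′ (toℕ k)
  c = fromℕ< (s≤s a≤g)
  off : ∀ k → k ≢ c → term k ≡ 0ℚ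
  off k k≢c with a == toℕ k in eq
  ... | true  = contradiction
                  (toℕ-injective (trans (sym (==⇒≡ a (toℕ k) eq)) (sym (toℕ-fromℕ< (s≤s a≤g)))))
                  k≢c
  ... | false = *-zeroʳ (binPmf p g (toℕ k))

groupFactor≡∏bernoulli : ∀ p s {n} (B A : SubsetE n) →
  (if s then groupSubsetProb p (countF n B) (countF n (λ e → B e ∧ A e))
        else indicator (countF n (λ e → B e ∧ A e) == 0))
  ≡ ∏ (λ e → if B e then bernoulli (if s then p else 0ℚ) (A e) else 1ℚ)
groupFactor≡∏bernoulli p true  {n} B A =
  trans (groupSubsetProb≡indepSubsetProb p (countF-∧-≤ n B A)) (sym (∏-bernoulli p n B A))
groupFactor≡∏bernoulli p false {n} B A =
  trans (sym (indepSubsetProb-0 (countF n B) (countF n (λ e → B e ∧ A e)))) (sym (∏-bernoulli 0ℚ n B A))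

inclusionProb : ∀ {n r} → ℚ → Partitions n r → Fin r → Fin n → ℚ
inclusionProb p P i e = if small P i (grp P i e) then p else 0ℚ

outcomeProb≡∏∏bernoulli : ∀ {n r} p (P : Partitions n r) ω →
  outcomeProb p P ω ≡ ∏ (λ i → ∏ (λ e → bernoulli (inclusionProb p P i e) (ω i e)))
outcomeProb≡∏∏bernoulli {n} {r} p P ω = begin
  outcomeProb p P ω
    ≡⟨ ΠF≡∏ r _ ⟩
  ∏ (λ i → ΠF (m P i) (groupFactor i))
    ≡⟨ ∏-cong (λ i → ΠF≡∏ (m P i) (groupFactor i)) ⟩
  ∏ (λ i → ∏ (groupFactor i))
    ≡⟨ ∏-cong (λ i → ∏-cong (λ b → groupFactor≡∏bernoulli p (small P i b) (inGroup i b) (ω i))) ⟩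
  ∏ (λ i → ∏ (λ b → ∏ (λ e → if grp P i e ==F b then edgeProb i b e else 1ℚ)))
    ≡⟨ ∏-cong (λ i → ∏-comm (λ b e → if grp P i e ==F b then edgeProb i b e else 1ℚ)) ⟩
  ∏ (λ i → ∏ (λ e → ∏ (λ b → if grp P i e ==F b then edgeProb i b e else 1ℚ)))
    ≡⟨ ∏-cong (λ i → ∏-cong (λ e → ∏-if-==F (grp P i e) (λ b → edgeProb i b e))) ⟩
  ∏ (λ i → ∏ (λ e → bernoulli (inclusionProb p P i e) (ω i e))) ∎
  where
  open ≡-Reasoning
  inGroup : (i : Fin r) → Fin (m P i) → SubsetE n
  inGroup i b e = grp P i e ==F b
  groupFactor : (i : Fin r) → Fin (m P i) → ℚ
  groupFactor i b =
    if small P i b then groupSubsetProb p (countF n (inGroup i b)) (countF n (λ e → inGroup i b e ∧ ω i e))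
    else indicator (countF n (λ e → inGroup i b e ∧ ω i e) == 0)
  edgeProb : (i : Fin r) → Fin (m P i) → Fin n → ℚ
  edgeProb i b e = bernoulli (if small P i b then p else 0ℚ) (ω i e)

δ : Bool → Bool → ℚ
δ true  true  = 1ℚ
δ false false = 1ℚ
δ _     _     = 0ℚ

m≤n⇒m==1+n≡false : ∀ {m n} → m ℕ.≤ n → (m == suc n) ≡ false
m≤n⇒m==1+n≡false {zero}  _         = refl
m≤n⇒m==1+n≡false {suc m} (s≤s m≤n) = m≤n⇒m==1+n≡false m≤n

indicator-==S : ∀ {n} (S T : SubsetE n) → indicator (S ==S T) ≡ ∏ (λ e → δ (S e) (T e))
indicator-==S {zero}  S T = refl
indicator-==S {suc n} S T with S zero | T zero
... | true  | true  = trans (indicator-==S (S ∘ suc) (T ∘ suc)) (sym (*-identityˡ _))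
... | false | false = trans (indicator-==S (S ∘ suc) (T ∘ suc)) (sym (*-identityˡ _))
... | true  | false = trans (cong indicator (m≤n⇒m==1+n≡false (countF-≤ n _)))
                            (sym (*-zeroˡ (∏ (λ e → δ (S (suc e)) (T (suc e))))))
... | false | true  = trans (cong indicator (m≤n⇒m==1+n≡false (countF-≤ n _)))
                            (sym (*-zeroˡ (∏ (λ e → δ (S (suc e)) (T (suc e))))))

findᵇ-unique : ∀ {A : Set} (p : A → Bool) (g : List A → Maybe A) →
  g [] ≡ nothing → (∀ x xs → g (x ∷ xs) ≡ (if p x then just x else g xs)) →
  ∀ xs → g xs ≡ findᵇ p xs
findᵇ-unique p g g-[] g-∷ []       = g-[]
findᵇ-unique p g g-[] g-∷ (x ∷ xs) rewrite g-∷ x xs | findᵇ-unique p g g-[] g-∷ xs = refl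

findᵇ-just : ∀ {A : Set} (p : A → Bool) {x xs} → x ∈ xs → p x ≡ true →
  ∃ λ y → findᵇ p xs ≡ just y × p y ≡ true
findᵇ-just p {xs = y ∷ ys} x∈           px with p y in py
findᵇ-just p {xs = y ∷ ys} x∈           px | true  = y , refl , py
findᵇ-just p {xs = y ∷ ys} (here refl)  px | false = contradiction (trans (sym px) py) λ ()
findᵇ-just p {xs = y ∷ ys} (there x∈ys) px | false = findᵇ-just p x∈ys px

-- firstSmall recurses through a local function that cannot be named here;
-- abstracting over allFins r lets unification supply it as g in findᵇ-unique.
firstSmall≡findᵇ : ∀ {n r} (P : Partitions n r) e →
  firstSmall P e ≡ findᵇ (λ i → small P i (grp P i e)) (allFins r)
firstSmall≡findᵇ {r = r} P e
  with findᵇ-unique (λ i → small P i (grp P i e)) _ refl (λ _ _ → refl) | allFins r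
... | go≡findᵇ | is = go≡findᵇ is

firstSmall-just : ∀ {n r} (P : Partitions n r) e → (∃ λ i → small P i (grp P i e) ≡ true) →
  ∃ λ i → firstSmall P e ≡ just i × small P i (grp P i e) ≡ true
firstSmall-just {r = r} P e (i , small-i) rewrite firstSmall≡findᵇ P e | allFins≡allFin r =
  findᵇ-just _ (∈-allFin i) small-i

output-firstSmall : ∀ {n r} (P : Partitions n r) ω e {i} → firstSmall P e ≡ just i → output P ω e ≡ ω i e
output-firstSmall P ω e eq rewrite eq = refl

Σℚ-cong : ∀ {A : Set} {f g : A → ℚ} xs → (∀ x → f x ≡ g x) → Σℚ (map f xs) ≡ Σℚ (map g xs)
Σℚ-cong xs f≗g = cong Σℚ (map-cong f≗g xs)

Σℚ-++ : ∀ xs ys → Σℚ (xs ++ ys) ≡ Σℚ xs + Σℚ ys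
Σℚ-++ []       ys = sym (+-identityˡ (Σℚ ys))
Σℚ-++ (x ∷ xs) ys = trans (cong (x +_) (Σℚ-++ xs ys)) (sym (+-assoc x (Σℚ xs) (Σℚ ys)))

Σℚ-concatMap-map : ∀ {A B C : Set} (F : C → ℚ) (φ : A → B → C) (L : List B) xs →
  Σℚ (map F (concatMap (λ a → map (φ a) L) xs)) ≡ Σℚ (map (λ a → Σℚ (map (F ∘ φ a) L)) xs)
Σℚ-concatMap-map F φ L []       = refl
Σℚ-concatMap-map F φ L (x ∷ xs) = begin
  Σℚ (map F (map (φ x) L ++ concatMap (λ a → map (φ a) L) xs))
    ≡⟨ cong Σℚ (map-++ F (map (φ x) L) _) ⟩
  Σℚ (map F (map (φ x) L) ++ map F (concatMap (λ a → map (φ a) L) xs))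
    ≡⟨ Σℚ-++ (map F (map (φ x) L)) _ ⟩
  Σℚ (map F (map (φ x) L)) + Σℚ (map F (concatMap (λ a → map (φ a) L) xs))
    ≡⟨ cong₂ _+_ (cong Σℚ (sym (map-∘ L))) (Σℚ-concatMap-map F φ L xs) ⟩
  Σℚ (map (F ∘ φ x) L) + Σℚ (map (λ a → Σℚ (map (F ∘ φ a) L)) xs) ∎
  where open ≡-Reasoning

Σℚ-*ˡ : ∀ {A : Set} c (f : A → ℚ) xs → Σℚ (map (λ x → c * f x) xs) ≡ c * Σℚ (map f xs)
Σℚ-*ˡ c f []       = sym (*-zeroʳ c)
Σℚ-*ˡ c f (x ∷ xs) = trans (cong (c * f x +_) (Σℚ-*ˡ c f xs)) (sym (*-distribˡ-+ c (f x) _))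

Σℚ-*ʳ : ∀ {A : Set} c (f : A → ℚ) xs → Σℚ (map (λ x → f x * c) xs) ≡ Σℚ (map f xs) * c
Σℚ-*ʳ c f []       = sym (*-zeroˡ c)
Σℚ-*ʳ c f (x ∷ xs) = trans (cong (f x * c +_) (Σℚ-*ʳ c f xs)) (sym (*-distribʳ-+ c (f x) _))

Σ-allFuns-∏ : ∀ {A : Set} (xs : List A) k (G : Fin k → A → ℚ) →
  Σℚ (map (λ ω → ∏ (λ j → G j (ω j))) (allFuns xs k)) ≡ ∏ (λ j → Σℚ (map (G j) xs))
Σ-allFuns-∏ xs zero    G = +-identityʳ 1ℚ
Σ-allFuns-∏ xs (suc k) G = begin
  Σℚ (map (λ ω → ∏ (λ j → G j (ω j))) (allFuns xs (suc k)))
    ≡⟨ Σℚ-concatMap-map _ _ (allFuns xs k) xs ⟩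
  Σℚ (map (λ a → Σℚ (map (λ ω → G zero a * ∏ (λ j → G (suc j) (ω j))) (allFuns xs k))) xs)
    ≡⟨ Σℚ-cong xs (λ a → Σℚ-*ˡ (G zero a) _ (allFuns xs k)) ⟩
  Σℚ (map (λ a → G zero a * Σℚ (map (λ ω → ∏ (λ j → G (suc j) (ω j))) (allFuns xs k))) xs)
    ≡⟨ Σℚ-*ʳ _ (G zero) xs ⟩
  Σℚ (map (G zero) xs) * Σℚ (map (λ ω → ∏ (λ j → G (suc j) (ω j))) (allFuns xs k))
    ≡⟨ cong (Σℚ (map (G zero) xs) *_) (Σ-allFuns-∏ xs k (G ∘ suc)) ⟩
  ∏ (λ j → Σℚ (map (G j) xs)) ∎
  where open ≡-Reasoning

if-else-0≡*indicator : ∀ b x → (if b then x else 0ℚ) ≡ x * indicator b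
if-else-0≡*indicator true  x = sym (*-identityʳ x)
if-else-0≡*indicator false x = sym (*-zeroʳ x)

Σ-bernoulli : ∀ q → Σℚ (map (bernoulli q) (true ∷ false ∷ [])) ≡ 1ℚ
Σ-bernoulli = solve 1 (λ q → q :+ ((con 1ℚ :- q) :+ con 0ℚ) := con 1ℚ) refl

Σ-bernoulli-δ : ∀ q y → Σℚ (map (λ x → bernoulli q x * δ x y) (true ∷ false ∷ [])) ≡ bernoulli q y
Σ-bernoulli-δ q true  = solve 1 (λ q → q :* con 1ℚ :+ ((con 1ℚ :- q) :* con 0ℚ :+ con 0ℚ) := q) refl q
Σ-bernoulli-δ q false =
  solve 1 (λ q → q :* con 0ℚ :+ ((con 1ℚ :- q) :* con 1ℚ :+ con 0ℚ) := con 1ℚ :- q) refl q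

∏-bernoulli≡probIndep : ∀ p {n} (T : SubsetE n) → ∏ (λ e → bernoulli p (T e)) ≡ probIndep p T
∏-bernoulli≡probIndep p {n} T =
  trans (∏-bernoulli p n (λ _ → true) T) (cong (λ g → indepSubsetProb p g (countF n T)) (countF-true n))

module _ {n r} (p : ℚ) (P : Partitions n r) (T : SubsetE n) (f : Fin n → Fin r)
         (f-first : ∀ e → firstSmall P e ≡ just (f e))
         (f-small : ∀ e → small P (f e) (grp P (f e) e) ≡ true) where

  edgeFactor : Fin r → Fin n → Bool → ℚ
  edgeFactor i e x = bernoulli (inclusionProb p P i e) x * (if f e ==F i then δ x (T e) else 1ℚ)

  summand-factorises : ∀ ω →
    (if output P ω ==S T then outcomeProb p P ω else 0ℚ) ≡ ∏ (λ i → ∏ (λ e → edgeFactor i e (ω i e)))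
  summand-factorises ω = begin
    (if output P ω ==S T then outcomeProb p P ω else 0ℚ)
      ≡⟨ if-else-0≡*indicator (output P ω ==S T) (outcomeProb p P ω) ⟩
    outcomeProb p P ω * indicator (output P ω ==S T)
      ≡⟨ cong₂ _*_ (outcomeProb≡∏∏bernoulli p P ω) (indicator-==S (output P ω) T) ⟩
    ∏ (λ i → ∏ (λ e → B i e)) * ∏ (λ e → δ (output P ω e) (T e))
      ≡⟨ cong (∏ (λ i → ∏ (λ e → B i e)) *_) (∏-cong δ-output) ⟩
    ∏ (λ i → ∏ (λ e → B i e)) * ∏ (λ e → ∏ (λ i → D i e))
      ≡⟨ cong (∏ (λ i → ∏ (λ e → B i e)) *_) (∏-comm (λ e i → D i e)) ⟩
    ∏ (λ i → ∏ (λ e → B i e)) * ∏ (λ i → ∏ (λ e → D i e))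
      ≡⟨ ∏-distrib-* (λ i → ∏ (λ e → B i e)) (λ i → ∏ (λ e → D i e)) ⟨
    ∏ (λ i → ∏ (λ e → B i e) * ∏ (λ e → D i e))
      ≡⟨ ∏-cong (λ i → ∏-distrib-* (B i) (D i)) ⟨
    ∏ (λ i → ∏ (λ e → edgeFactor i e (ω i e))) ∎
    where
    open ≡-Reasoning
    B D : Fin r → Fin n → ℚ
    B i e = bernoulli (inclusionProb p P i e) (ω i e)
    D i e = if f e ==F i then δ (ω i e) (T e) else 1ℚ
    δ-output : ∀ e → δ (output P ω e) (T e) ≡ ∏ (λ i → D i e)
    δ-output e = begin
      δ (output P ω e) (T e)  ≡⟨ cong (λ x → δ x (T e)) (output-firstSmall P ω e (f-first e)) ⟩
      δ (ω (f e) e) (T e)     ≡⟨ ∏-if-==F (f e) (λ i → δ (ω i e) (T e)) ⟨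
      ∏ (λ i → D i e)         ∎

  Σ-edgeFactor : ∀ i e →
    Σℚ (map (edgeFactor i e) (true ∷ false ∷ [])) ≡ (if f e ==F i then bernoulli p (T e) else 1ℚ)
  Σ-edgeFactor i e with f e ==F i in fe==i
  ... | false = trans (Σℚ-cong (true ∷ false ∷ []) (λ x → *-identityʳ (bernoulli q x))) (Σ-bernoulli q)
    where q = inclusionProb p P i e
  ... | true with ==F⇒≡ (f e) i fe==i
  ...   | refl rewrite f-small e = Σ-bernoulli-δ p (T e)

  probOutput≡∏bernoulli : probOutput p P T ≡ ∏ (λ e → bernoulli p (T e))
  probOutput≡∏bernoulli = begin
    probOutput p P T
      ≡⟨ Σℚ-cong (allFuns (allSubsetsE n) r) summand-factorises ⟩
    Σℚ (map (λ ω → ∏ (λ i → ∏ (λ e → edgeFactor i e (ω i e)))) (allFuns (allSubsetsE n) r))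
      ≡⟨ Σ-allFuns-∏ (allSubsetsE n) r (λ i A → ∏ (λ e → edgeFactor i e (A e))) ⟩
    ∏ (λ i → Σℚ (map (λ A → ∏ (λ e → edgeFactor i e (A e))) (allSubsetsE n)))
      ≡⟨ ∏-cong (λ i → Σ-allFuns-∏ (true ∷ false ∷ []) n (edgeFactor i)) ⟩
    ∏ (λ i → ∏ (λ e → Σℚ (map (edgeFactor i e) (true ∷ false ∷ []))))
      ≡⟨ ∏-comm (λ i e → Σℚ (map (edgeFactor i e) (true ∷ false ∷ []))) ⟩
    ∏ (λ e → ∏ (λ i → Σℚ (map (edgeFactor i e) (true ∷ false ∷ []))))
      ≡⟨ ∏-cong (λ e → trans (∏-cong (λ i → Σ-edgeFactor i e))
                             (∏-if-==F (f e) (λ _ → bernoulli p (T e)))) ⟩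
    ∏ (λ e → bernoulli p (T e)) ∎
    where open ≡-Reasoning

lemma2 : (n r : ℕ) (p : ℚ) → 0ℚ ≤ p → p ≤ 1ℚ →
    (P : Partitions n r) →
    ((e : Fin n) → ∃ λ (i : Fin r) → small P i (grp P i e) ≡ true) →
    (T : SubsetE n) → probOutput p P T ≡ probIndep p T
lemma2 n r p _ _ P hyp T = begin
  probOutput p P T             ≡⟨ probOutput≡∏bernoulli p P T f (λ e → proj₁ (proj₂ (first e)))
                                                                (λ e → proj₂ (proj₂ (first e))) ⟩
  ∏ (λ e → bernoulli p (T e))  ≡⟨ ∏-bernoulli≡probIndep p T ⟩
  probIndep p T                ∎
  where
  open ≡-Reasoning
  first : ∀ e → ∃ λ i → firstSmall P e ≡ just i × small P i (grp P i e) ≡ true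
  first e = firstSmall-just P e (hyp e)
  f : Fin n → Fin r
  f e = proj₁ (first e)
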